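{- $\mathrm{Ind}\,\mathbb{Q}_2\not\le_W\lim$.
   Context: A problem is a partial multivalued function $P\colon\subseteq\mathbb{N}^\mathbb{N}\rightrightarrows\mathbb{N}^\mathbb{N}$. $P\le_W Q$ means there are Turing functionals $\Delta,\Psi$ with $\Delta^p\in\mathrm{dom}\,Q$ for all $p\in\mathrm{dom}\,P$ and $\Psi^{p\oplus q}\in P(p)$ for all $q\in Q(\Delta^p)$. $\lim$: instances are sequences $\langle p_0,p_1,\dots\rangle$ of elements of $\mathbb{N}^\mathbb{N}$ converging (pointwise) in Baire space; the solution is the limit. $\mathrm{Ind}\,\mathbb{Q}_2$: instances are pairs $\langle\mathcal{A},c\rangle$ with $\mathcal{A}$ a presentation of the linear order $\mathbb{Q}$ and $c\colon\mathrm{dom}\,\mathcal{A}\to\{0,1\}$; solutions are $c$-monochromatic sets whose induced suborder is isomorphic to $\mathbb{Q}$. -}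

module Defs where

open import Data.Nat using (ℕ; zero; suc; _+_; _*_; _≤_; _<_)
open import Data.Fin using (Fin)
open import Data.Vec using (Vec; []; _∷_; lookup)
open import Data.Product using (Σ; _×_; proj₁)
open import Data.Rational using (ℚ) renaming (_<_ to _<ℚ_)
open import Function.Bundles using (_⇔_)
open import Function.Definitions using (Bijective)
open import Relation.Binary.PropositionalEquality using (_≡_)

Baire : Set
Baire = ℕ → ℕ

-- Oracle partial recursive functions (model of Turing functionals)

data PR : ℕ → Set where
  zer  : ∀ {n} → PR n
  succ : PR 1
  proj : ∀ {n} → Fin n → PR n
  orc  : PR 1
  comp : ∀ {m n} → PR m → Vec (PR n) m → PR n
  prec : ∀ {n} → PR n → PR (suc (suc n)) → PR (suc n)
  mu   : ∀ {n} → PR (suc n) → PR n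

data Eval (p : Baire) : ∀ {n} → PR n → Vec ℕ n → ℕ → Set
data EvalV (p : Baire) : ∀ {n m} → Vec (PR n) m → Vec ℕ n → Vec ℕ m → Set

data Eval p where
  e-zer  : ∀ {n} {xs : Vec ℕ n} → Eval p zer xs 0
  e-succ : ∀ {x} → Eval p succ (x ∷ []) (suc x)
  e-proj : ∀ {n} {i : Fin n} {xs} → Eval p (proj i) xs (lookup xs i)
  e-orc  : ∀ {x} → Eval p orc (x ∷ []) (p x)
  e-comp : ∀ {m n} {f : PR m} {gs : Vec (PR n) m} {xs ys v} →
           EvalV p gs xs ys → Eval p f ys v → Eval p (comp f gs) xs v
  e-prec0 : ∀ {n} {f : PR n} {g} {xs v} →
            Eval p f xs v → Eval p (prec f g) (0 ∷ xs) v
  e-precS : ∀ {n} {f : PR n} {g} {k xs r v} →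
            Eval p (prec f g) (k ∷ xs) r → Eval p g (k ∷ r ∷ xs) v →
            Eval p (prec f g) (suc k ∷ xs) v
  e-mu   : ∀ {n} {f : PR (suc n)} {xs y} →
           Eval p f (y ∷ xs) 0 →
           (∀ z → z < y → Σ ℕ (λ w → Eval p f (z ∷ xs) (suc w))) →
           Eval p (mu f) xs y

data EvalV p where
  ev-[] : ∀ {n} {xs : Vec ℕ n} → EvalV p [] xs []
  ev-∷  : ∀ {n m} {g : PR n} {gs : Vec (PR n) m} {xs y ys} →
          Eval p g xs y → EvalV p gs xs ys → EvalV p (g ∷ gs) xs (y ∷ ys)

Computes : PR 1 → Baire → Baire → Set
Computes t p d = ∀ n → Eval p t (n ∷ []) (d n)

-- join p ⊕ q : (p⊕q)(2n) = p n, (p⊕q)(2n+1) = q n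
join : Baire → Baire → Baire
join p q zero = p 0
join p q (suc zero) = q 0
join p q (suc (suc n)) = join (λ k → p (suc k)) (λ k → q (suc k)) n

left right : Baire → Baire
left p n = p (2 * n)
right p n = p (suc (2 * n))

tri : ℕ → ℕ
tri zero = zero
tri (suc k) = suc k + tri k

pair : ℕ → ℕ → ℕ
pair a b = tri (a + b) + b

record Problem : Set₁ where
  field
    Dom : Baire → Set
    Sol : Baire → Baire → Set
open Problem public

_≤W_ : Problem → Problem → Set
P ≤W Q = Σ (PR 1) λ Δ → Σ (PR 1) λ Ψ →
  ∀ p → Dom P p →
    Σ Baire λ d → Computes Δ p d × Dom Q d ×
      (∀ q → Sol Q d q → Σ Baire λ s → Computes Ψ (join p q) s × Sol P p s)

-- lim : p codes the sequence ⟨p₀,p₁,…⟩ with pᵢ(n) = p(pair i n)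

IsLimit : Baire → Baire → Set
IsLimit p q = ∀ n → Σ ℕ λ N → ∀ i → N ≤ i → p (pair i n) ≡ q n

Lim : Problem
Lim = record { Dom = λ p → Σ Baire (IsLimit p) ; Sol = IsLimit }

LtA : Baire → ℕ → ℕ → Set
LtA A a b = A (pair a b) ≡ 1

IsoToℚ : (X : Set) → (X → X → Set) → Set
IsoToℚ X R = Σ (X → ℚ) λ f → Bijective _≡_ _≡_ f × (∀ x y → R x y ⇔ (f x <ℚ f y))

IsQPres : Baire → Set
IsQPres A = IsoToℚ ℕ (LtA A)

-- sets coded by characteristic functions: n ∈ S iff q n = 1
Elem : Baire → Set
Elem q = Σ ℕ λ n → q n ≡ 1

IndQ2 : Problem
IndQ2 = record
  { Dom = λ p → IsQPres (left p) × (∀ n → right p n < 2)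
  ; Sol = λ p q →
      Σ ℕ (λ i → ∀ n → q n ≡ 1 → right p n ≡ i) ×
      IsoToℚ (Elem q) (λ x y → LtA (left p) (proj₁ x) (proj₁ y))
  }

-- Fix a presentation A of ℚ and a candidate reduction (Δ, Ψ), and colour ℕ by diagonalisation.
-- At stage n, knowing the colouring below n, run Δ and then Ψ for n steps on A ⊕ colouring,
-- feeding Ψ the t-th term of Δ's sequence in place of its limit; for the largest t ≤ n for which
-- Ψ thereby exhibits a first element k < n of its solution, give n the colour opposite to k's.
-- If (Δ, Ψ) were a reduction, with limit q₀ and solution s with first element k₀, then Ψ decides
-- s up to k₀ from finitely many values of q₀, which the terms of the sequence take from some T on.
-- So at every large stage the trials with t ≥ T that succeed exhibit k₀, the trial t = T succeeds,
-- and n is coloured opposite to k₀. The monochromatic solution s is then finite, so not ≅ ℚ.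

{-# OPTIONS --safe #-}
module Submission where

open import Defs
open import Data.Empty using (⊥)
open import Data.Fin as Fin using (Fin; toℕ; fromℕ<)
open import Data.Fin.Properties using (pigeonhole; toℕ-fromℕ<)
open import Data.Integer using (ℤ; +_; -[1+_]) renaming (∣_∣ to ∣_∣ℤ)
open import Data.List using (List; []; _∷_; map)
open import Data.List.Membership.Propositional using (_∈_; _∉_)
open import Data.List.Relation.Unary.Any using (here; there)
open import Data.Maybe as Maybe using (Maybe; just; nothing; _>>=_; _<∣>_; fromMaybe)
open import Data.Maybe.Properties using (just-injective; map-just)
open import Data.Nat hiding (_/_)
open import Data.Nat.Coprimality using (1-coprimeTo) renaming (sym to coprime-sym)
open import Data.Nat.ListAction using (sum)
open import Data.Nat.Properties
open import Data.Product using (∃; ∃₂; ∃-syntax; _×_; _,_; proj₁; proj₂; uncurry)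
open import Data.Rational using (ℚ; mkℚ; _/_; ↥_; ↧ₙ_; 0ℚ) renaming (_<_ to _<ℚ_)
open import Data.Rational.Properties using (↥p/↧p≡p) renaming (_≟_ to _≟ℚ_; _<?_ to _<ℚ?_)
open import Data.Sum using (inj₁; inj₂)
open import Data.Vec using (Vec; []; _∷_; lookup)
open import Function using (_∘_)
open import Function.Bundles using (_⇔_; mk⇔; Equivalence)
open import Function.Consequences.Propositional using (strictlySurjective⇒surjective)
open import Function.Definitions using (Injective; Surjective; Bijective)
open import Relation.Binary.Definitions using (DecidableEquality; tri<; tri≈; tri>)
open import Relation.Binary.PropositionalEquality
open import Relation.Nullary using (¬_; Dec; yes; no; ¬?; contradiction)
open import Relation.Unary using (Decidable)

-- Partial oracles and first-index search

Oracle : Set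
Oracle = ℕ → Maybe ℕ

infix 4 _⊑_
_⊑_ : Oracle → Oracle → Set
o ⊑ o′ = ∀ x {v} → o x ≡ just v → o′ x ≡ just v

total : Baire → Oracle
total p x = just (p x)

Agrees : Oracle → Baire → ℕ → Set
Agrees o p B = ∀ {x} → x < B → o x ≡ just (p x)

Agrees-≤ : ∀ {o p B B′} → B′ ≤ B → Agrees o p B → Agrees o p B′
Agrees-≤ B′≤B a x<B′ = a (<-≤-trans x<B′ B′≤B)

>>=-just⁻¹ : ∀ {A B : Set} (m : Maybe A) {f : A → Maybe B} {v} →
             (m >>= f) ≡ just v → ∃[ a ] m ≡ just a × f a ≡ just v
>>=-just⁻¹ (just a) e = a , refl , e

>>=-just : ∀ {A B : Set} {m : Maybe A} {a} (f : A → Maybe B) → m ≡ just a → (m >>= f) ≡ f a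
>>=-just f refl = refl

FirstIndexOf : ℕ → Oracle → ℕ → Set
FirstIndexOf v S k = S k ≡ just v × (∀ {j} → j < k → ∃[ w ] S j ≡ just w × w ≢ v)

firstIndexOf : ℕ → ℕ → Oracle → Maybe ℕ
firstIndexOf v zero    S = nothing
firstIndexOf v (suc b) S with S 0
... | nothing = nothing
... | just w with w ≟ v
...   | yes _ = just 0
...   | no _  = Maybe.map suc (firstIndexOf v b (S ∘ suc))

FirstIndexOf-transfer : ∀ {v S S′ k} → (∀ {j w} → j ≤ k → S j ≡ just w → S′ j ≡ just w) →
                        FirstIndexOf v S k → FirstIndexOf v S′ k
FirstIndexOf-transfer S⊑S′ (Sk , before) =
  S⊑S′ ≤-refl Sk , λ j<k → let w , Sj , w≢v = before j<k in w , S⊑S′ (<⇒≤ j<k) Sj , w≢v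

FirstIndexOf-unique : ∀ {v S S′ k k′} → FirstIndexOf v S k → FirstIndexOf v S′ k′ →
                      (∀ {j a b} → j ≤ k′ → S j ≡ just a → S′ j ≡ just b → a ≡ b) → k ≡ k′
FirstIndexOf-unique {k = k} {k′} (Sk , before) (S′k′ , before′) compatible with <-cmp k k′
... | tri≈ _ k≡k′ _ = k≡k′
... | tri< k<k′ _ _ = let w , S′k , w≢v = before′ k<k′ in
  contradiction (sym (compatible (<⇒≤ k<k′) Sk S′k)) w≢v
... | tri> _ _ k>k′ = let w , Sk′ , w≢v = before k>k′ in
  contradiction (compatible ≤-refl Sk′ S′k′) w≢v

firstIndexOf-sound : ∀ {v} b S {k} → firstIndexOf v b S ≡ just k → k < b × FirstIndexOf v S k
firstIndexOf-sound {v} (suc b) S e with S 0 in S0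
... | just w with w ≟ v
...   | yes refl with refl ← e = z<s , S0 , λ ()
...   | no w≢v with firstIndexOf v b (S ∘ suc) in found
...     | just k with refl ← e =
  let k<b , Sk , before = firstIndexOf-sound b (S ∘ suc) found in
  s<s k<b , Sk , λ { {zero} _ → w , S0 , w≢v ; {suc j} (s<s j<k) → before j<k }

firstIndexOf-complete : ∀ {v} b S {k} → FirstIndexOf v S k → k < b → firstIndexOf v b S ≡ just k
firstIndexOf-complete {v} (suc b) S {zero} (S0 , _) _ rewrite S0 with v ≟ v
... | yes _   = refl
... | no v≢v = contradiction refl v≢v
firstIndexOf-complete {v} (suc b) S {suc k} (Sk , before) (s<s k<b)
  with w , S0 , w≢v ← before z<s rewrite S0 with w ≟ v
... | yes w≡v = contradiction w≡v w≢v
... | no _ = map-just (firstIndexOf-complete b (S ∘ suc) (Sk , λ j<k → before (s<s j<k)) k<b)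

firstIndexOf-mono : ∀ {v b b′ S S′ k} → b ≤ b′ → S ⊑ S′ →
                    firstIndexOf v b S ≡ just k → firstIndexOf v b′ S′ ≡ just k
firstIndexOf-mono {b = b} {b′} {S} {S′} b≤b′ S⊑S′ e =
  let k<b , first = firstIndexOf-sound b S e in
  firstIndexOf-complete b′ S′ (FirstIndexOf-transfer (λ _ → S⊑S′ _) first) (<-≤-trans k<b b≤b′)

-- Fuel-bounded evaluation relative to a partial oracle

run : ∀ {n} → ℕ → Oracle → PR n → Vec ℕ n → Maybe ℕ
runV : ∀ {n m} → ℕ → Oracle → Vec (PR n) m → Vec ℕ n → Maybe (Vec ℕ m)
runPrec : ∀ {n} → ℕ → Oracle → PR n → PR (suc (suc n)) → ℕ → Vec ℕ n → Maybe ℕ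

run zero    o t           xs       = nothing
run (suc k) o zer         xs       = just 0
run (suc k) o succ        (x ∷ []) = just (suc x)
run (suc k) o (proj i)    xs       = just (lookup xs i)
run (suc k) o orc         (x ∷ []) = o x
run (suc k) o (comp f gs) xs       = runV k o gs xs >>= run k o f
run (suc k) o (prec f g)  (x ∷ xs) = runPrec k o f g x xs
run (suc k) o (mu f)      xs       = firstIndexOf 0 k (λ y → run k o f (y ∷ xs))

runV k o []       xs = just []
runV k o (g ∷ gs) xs = run k o g xs >>= λ y → runV k o gs xs >>= λ ys → just (y ∷ ys)

runPrec k o f g zero    xs = run k o f xs
runPrec k o f g (suc x) xs = runPrec k o f g x xs >>= λ r → run k o g (x ∷ r ∷ xs)

run-mono : ∀ {n k k′ o o′} (t : PR n) xs {v} → k ≤ k′ → o ⊑ o′ →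
           run k o t xs ≡ just v → run k′ o′ t xs ≡ just v
runV-mono : ∀ {n m k k′ o o′} (gs : Vec (PR n) m) xs {vs} → k ≤ k′ → o ⊑ o′ →
            runV k o gs xs ≡ just vs → runV k′ o′ gs xs ≡ just vs
runPrec-mono : ∀ {n k k′ o o′} f g x (xs : Vec ℕ n) {v} → k ≤ k′ → o ⊑ o′ →
               runPrec k o f g x xs ≡ just v → runPrec k′ o′ f g x xs ≡ just v

run-mono zer         xs       (s≤s _) o⊑o′ e = e
run-mono succ        (x ∷ []) (s≤s _) o⊑o′ e = e
run-mono (proj i)    xs       (s≤s _) o⊑o′ e = e
run-mono orc         (x ∷ []) (s≤s _) o⊑o′ e = o⊑o′ x e
run-mono {k = suc k} {o = o} (comp f gs) xs (s≤s k≤k′) o⊑o′ e =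
  let ys , gs↓ , f↓ = >>=-just⁻¹ (runV k o gs xs) e in
  trans (>>=-just _ (runV-mono gs xs k≤k′ o⊑o′ gs↓)) (run-mono f ys k≤k′ o⊑o′ f↓)
run-mono (prec f g) (x ∷ xs) (s≤s k≤k′) o⊑o′ e = runPrec-mono f g x xs k≤k′ o⊑o′ e
run-mono (mu f)     xs       (s≤s k≤k′) o⊑o′ e =
  firstIndexOf-mono k≤k′ (λ y → run-mono f (y ∷ xs) k≤k′ o⊑o′) e

runV-mono []       xs k≤k′ o⊑o′ e = e
runV-mono {k = k} {o = o} (g ∷ gs) xs k≤k′ o⊑o′ e
  with y , g↓ , rest ← >>=-just⁻¹ (run k o g xs) e
  with ys , gs↓ , refl ← >>=-just⁻¹ (runV k o gs xs) rest =
  trans (>>=-just _ (run-mono g xs k≤k′ o⊑o′ g↓)) (>>=-just _ (runV-mono gs xs k≤k′ o⊑o′ gs↓))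

runPrec-mono f g zero    xs k≤k′ o⊑o′ e = run-mono f xs k≤k′ o⊑o′ e
runPrec-mono {k = k} {o = o} f g (suc x) xs k≤k′ o⊑o′ e =
  let r , rec↓ , g↓ = >>=-just⁻¹ (runPrec k o f g x xs) e in
  trans (>>=-just _ (runPrec-mono f g x xs k≤k′ o⊑o′ rec↓)) (run-mono g _ k≤k′ o⊑o′ g↓)

common-bound : (P : ℕ → ℕ → Set) → (∀ {x K K′} → K ≤ K′ → P x K → P x K′) →
               ∀ m → (∀ {x} → x < m → ∃ (P x)) → ∃[ K ] ∀ {x} → x < m → P x K
common-bound P up zero    _ = 0 , λ ()
common-bound P up (suc m) h
  with K , below ← common-bound P up m (λ x<m → h (m<n⇒m<1+n x<m))
  with K′ , at-m ← h (n<1+n m) = K ⊔ K′ , bound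
  where
  bound : ∀ {x} → x < suc m → P x (K ⊔ K′)
  bound x<1+m with m≤n⇒m<n∨m≡n (s≤s⁻¹ x<1+m)
  ... | inj₁ x<m = up (m≤m⊔n K K′) (below x<m)
  ... | inj₂ refl = up (m≤n⊔m K K′) at-m

Settles : {A : Set} → (ℕ → Oracle → Maybe A) → Baire → A → ℕ → Set
Settles r p v K = ∀ {k o} → K ≤ k → Agrees o p K → r k o ≡ just v

module _ {A : Set} {r : ℕ → Oracle → Maybe A} {p : Baire} {v : A} where

  Settles-≤ : ∀ {K K′} → K ≤ K′ → Settles r p v K → Settles r p v K′
  Settles-≤ K≤K′ S K′≤k a = S (≤-trans K≤K′ K′≤k) (Agrees-≤ K≤K′ a)

  settles-below : ∀ {K L k o} → Settles r p v K → K ≤ L → L ≤ k → Agrees o p (suc L) →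
                  r k o ≡ just v
  settles-below S K≤L L≤k a = S (≤-trans K≤L L≤k) (Agrees-≤ (m≤n⇒m≤1+n K≤L) a)

eval-settles : ∀ {p n} {t : PR n} {xs v} → Eval p t xs v → ∃ (Settles (λ k o → run k o t xs) p v)
evalV-settles : ∀ {p n m} {gs : Vec (PR n) m} {xs vs} → EvalV p gs xs vs →
                ∃ (Settles (λ k o → runV k o gs xs) p vs)

eval-settles e-zer  = 1 , λ { (s≤s _) _ → refl }
eval-settles e-succ = 1 , λ { (s≤s _) _ → refl }
eval-settles e-proj = 1 , λ { (s≤s _) _ → refl }
eval-settles (e-orc {x}) = suc x , λ { (s≤s _) a → a ≤-refl }
eval-settles (e-comp gs↓ f↓) with K₁ , S₁ ← evalV-settles gs↓ | K₂ , S₂ ← eval-settles f↓ =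
  suc (K₁ ⊔ K₂) , λ { (s≤s L≤k) a →
    trans (>>=-just _ (settles-below S₁ (m≤m⊔n K₁ K₂) L≤k a))
          (settles-below S₂ (m≤n⊔m K₁ K₂) L≤k a) }
eval-settles (e-prec0 f↓) with K , S ← eval-settles f↓ =
  suc K , λ { (s≤s K≤k) a → settles-below S ≤-refl K≤k a }
eval-settles (e-precS rec↓ g↓) with K₁ , S₁ ← eval-settles rec↓ | K₂ , S₂ ← eval-settles g↓ =
  suc (K₁ ⊔ K₂) , λ { (s≤s L≤k) a →
    trans (>>=-just _ (settles-below S₁ (m≤m⊔n K₁ K₂) (m≤n⇒m≤1+n L≤k) a))
          (settles-below S₂ (m≤n⊔m K₁ K₂) L≤k a) }
eval-settles {p} (e-mu {f = f} {xs} {y} f↓0 f↓suc)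
  with K₀ , S₀ ← eval-settles f↓0
  with K , S ← common-bound (λ z K → ∃[ w ] Settles (λ k o → run k o f (z ∷ xs)) p (suc w) K)
                 (λ K≤K′ (w , S) → w , Settles-≤ K≤K′ S) y
                 (λ {z} z<y → let w , f↓ = f↓suc z z<y ; K , S = eval-settles f↓ in K , w , S) =
  suc L , λ { (s≤s L≤k) a → firstIndexOf-complete _ _
    ( settles-below S₀ (m≤n⇒m≤n⊔o (suc y) (m≤m⊔n K₀ K)) L≤k a
    , λ z<y → let w , Sz = S z<y in
        suc w , settles-below Sz (m≤n⇒m≤n⊔o (suc y) (m≤n⊔m K₀ K)) L≤k a , λ () )
    (≤-trans (m≤n⊔m (K₀ ⊔ K) (suc y)) L≤k) }
  where
  L : ℕ
  L = K₀ ⊔ K ⊔ suc y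

evalV-settles ev-[] = 0 , λ _ _ → refl
evalV-settles (ev-∷ g↓ gs↓) with K₁ , S₁ ← eval-settles g↓ | K₂ , S₂ ← evalV-settles gs↓ =
  K₁ ⊔ K₂ , λ L≤k a →
    trans (>>=-just _ (Settles-≤ (m≤m⊔n K₁ K₂) S₁ L≤k a))
          (cong (_>>= _) (Settles-≤ (m≤n⊔m K₁ K₂) S₂ L≤k a))

run-sound : ∀ {n p o o′ K k} {t : PR n} {xs v w} → o ⊑ o′ →
            Settles (λ k o → run k o t xs) p v K → Agrees o′ p K → run k o t xs ≡ just w → w ≡ v
run-sound {K = K} {k} {t} {xs} o⊑o′ S a e =
  just-injective (trans (sym (run-mono t xs (m≤m⊔n k K) o⊑o′ e)) (S (m≤n⊔m k K) a))

joinₒ : Oracle → Oracle → Oracle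
joinₒ o o′ zero          = o 0
joinₒ o o′ (suc zero)    = o′ 0
joinₒ o o′ (suc (suc x)) = joinₒ (o ∘ suc) (o′ ∘ suc) x

joinₒ-mono : ∀ {o₁ o₁′ o₂ o₂′} → o₁ ⊑ o₁′ → o₂ ⊑ o₂′ → joinₒ o₁ o₂ ⊑ joinₒ o₁′ o₂′
joinₒ-mono o₁⊑ o₂⊑ zero          = o₁⊑ 0
joinₒ-mono o₁⊑ o₂⊑ (suc zero)    = o₂⊑ 0
joinₒ-mono o₁⊑ o₂⊑ (suc (suc x)) = joinₒ-mono (o₁⊑ ∘ suc) (o₂⊑ ∘ suc) x

joinₒ-total : ∀ {p q} → joinₒ (total p) (total q) ⊑ total (join p q)
joinₒ-total         zero          e = e
joinₒ-total         (suc zero)    e = e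
joinₒ-total {p} {q} (suc (suc x)) e = joinₒ-total {p ∘ suc} {q ∘ suc} x e

joinₒ-agrees : ∀ {o₁ o₂ p q B} → Agrees o₁ p B → Agrees o₂ q B → Agrees (joinₒ o₁ o₂) (join p q) B
joinₒ-agrees {B = suc B} a₁ a₂ {zero}        _ = a₁ z<s
joinₒ-agrees {B = suc B} a₁ a₂ {suc zero}    _ = a₂ z<s
joinₒ-agrees {B = suc B} a₁ a₂ {suc (suc x)} (s<s x+1<B) =
  joinₒ-agrees {B = B} (λ y<B → a₁ (s<s y<B)) (λ y<B → a₂ (s<s y<B)) (≤-trans (n≤1+n (suc x)) x+1<B)

left-join : ∀ p q n → left (join p q) n ≡ p n
right-join : ∀ p q n → right (join p q) n ≡ q n
left-join p q n rewrite +-identityʳ n = join-even n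
  where
  join-even : ∀ {p q} n → join p q (n + n) ≡ p n
  join-even zero = refl
  join-even {p} {q} (suc n) rewrite +-suc n n = join-even {p ∘ suc} {q ∘ suc} n
right-join p q n rewrite +-identityʳ n = join-odd n
  where
  join-odd : ∀ {p q} n → join p q (suc (n + n)) ≡ q n
  join-odd zero = refl
  join-odd {p} {q} (suc n) rewrite +-suc n n = join-odd {p ∘ suc} {q ∘ suc} n

restrict : Baire → ℕ → Oracle
restrict f n x with x <? n
... | yes _ = just (f x)
... | no _  = nothing

module _ {f c : Baire} {n : ℕ} (f≡c : ∀ {x} → x < n → f x ≡ c x) where

  restrict-⊑ : restrict f n ⊑ total c
  restrict-⊑ x e with x <? n
  restrict-⊑ x refl | yes x<n = cong just (sym (f≡c x<n))

  restrict-agrees : Agrees (restrict f n) c n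
  restrict-agrees {x} x<n with x <? n
  ... | yes _    = cong just (f≡c x<n)
  ... | no x≮n = contradiction x<n x≮n

Least : (ℕ → Set) → ℕ → Set
Least P k = P k × (∀ {j} → j < k → ¬ P j)

∃-least : ∀ {P : ℕ → Set} → Decidable P → ∀ {m} → P m → ∃ (Least P)
∃-least P? {zero}  p₀ = 0 , p₀ , λ ()
∃-least P? {suc m} pm with P? 0
... | yes p₀ = 0 , p₀ , λ ()
... | no ¬p₀ with k , pk , below ← ∃-least (P? ∘ suc) pm =
  suc k , pk , λ { {zero} _ → ¬p₀ ; {suc j} (s<s j<k) → below j<k }

∃-FirstIndexOf : ∀ {s v k} → s k ≡ v → ∃ (FirstIndexOf v (total s))
∃-FirstIndexOf {s} {v} sk≡v with k , sk , below ← ∃-least (λ j → s j ≟ v) sk≡v =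
  k , cong just sk , λ j<k → s _ , refl , below j<k

latest : {A : Set} → (ℕ → Maybe A) → ℕ → Maybe A
latest tr zero    = tr zero
latest tr (suc t) = tr (suc t) <∣> latest tr t

latest-eventually : ∀ {A : Set} {tr : ℕ → Maybe A} {T a i} → tr T ≡ just a →
                    (∀ {t b} → T ≤ t → tr t ≡ just b → b ≡ i) → ∀ {n} → T ≤ n → latest tr n ≡ just i
latest-eventually trT sound {zero} z≤n = trans trT (cong just (sound z≤n trT))
latest-eventually {tr = tr} trT sound {suc n} T≤n with tr (suc n) in trn
... | just b  = cong just (sound T≤n trn)
... | nothing with m≤n⇒m<n∨m≡n T≤n
...   | inj₁ T<1+n = latest-eventually trT sound (s≤s⁻¹ T<1+n)
...   | inj₂ refl  = contradiction (trans (sym trn) trT) λ ()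

-- The diagonal colouring

otherColour : ℕ → ℕ
otherColour zero    = 1
otherColour (suc _) = 0

otherColour-≢ : ∀ i → otherColour i ≢ i
otherColour-≢ zero    ()
otherColour-≢ (suc i) ()

otherColour<2 : ∀ i → otherColour i < 2
otherColour<2 zero    = s<s z<s
otherColour<2 (suc i) = z<s

module Diagonal (A : Baire) (Δ Ψ : PR 1) where

  approxInstance : Oracle → Oracle
  approxInstance u = joinₒ (total A) u

  approxTerm : ℕ → Oracle → ℕ → Oracle
  approxTerm n u t x = run n (approxInstance u) Δ (pair t x ∷ [])

  approxSolution : ℕ → Oracle → ℕ → Oracle
  approxSolution n u t j = run n (joinₒ (approxInstance u) (approxTerm n u t)) Ψ (j ∷ [])

  trial : ℕ → Oracle → ℕ → Maybe ℕ
  trial n u t = firstIndexOf 1 n (approxSolution n u t) >>= u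

  guess : ℕ → Oracle → ℕ
  guess n u = fromMaybe 0 (latest (trial n u) n)

  prefix : ℕ → Baire
  colouring : Baire

  prefix zero    x = 0
  prefix (suc n) x with x ≟ n
  ... | yes _ = colouring n
  ... | no _  = prefix n x

  colouring n = otherColour (guess n (restrict (prefix n) n))

  prefix-colouring : ∀ {n x} → x < n → prefix n x ≡ colouring x
  prefix-colouring {suc n} {x} x<1+n with x ≟ n
  ... | yes refl = refl
  ... | no x≢n  = prefix-colouring (≤∧≢⇒< (s≤s⁻¹ x<1+n) x≢n)

  module _ {c d q₀ s : Baire} {k₀ : ℕ} (Δ↓ : Computes Δ (join A c) d) (d→q₀ : IsLimit d q₀)
           (Ψ↓ : Computes Ψ (join (join A c) q₀) s) (first : FirstIndexOf 1 (total s) k₀) where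

    private
      p : Baire
      p = join A c

      SettlesΨ : ℕ → ℕ → Set
      SettlesΨ j = Settles (λ k o → run k o Ψ (j ∷ [])) (join p q₀) (s j)

      Converged : ℕ → ℕ → Set
      Converged x T = ∀ {t} → T ≤ t → d (pair t x) ≡ q₀ x

      SettlesΔ : ℕ → ℕ → ℕ → Set
      SettlesΔ T x = Settles (λ k o → run k o Δ (pair T x ∷ [])) p (d (pair T x))

      boundΨ : ∃[ K ] ∀ {j} → j < suc k₀ → SettlesΨ j K
      boundΨ = common-bound SettlesΨ Settles-≤ (suc k₀) (λ {j} _ → eval-settles (Ψ↓ j))

      Kψ : ℕ
      Kψ = proj₁ boundΨ

      settlesΨ : ∀ {j} → j < suc k₀ → SettlesΨ j Kψ
      settlesΨ = proj₂ boundΨ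

      convergence : ∃[ T ] ∀ {x} → x < Kψ → Converged x T
      convergence = common-bound Converged (λ T≤T′ conv T′≤t → conv (≤-trans T≤T′ T′≤t)) Kψ
                      (λ {x} _ → let N , conv = d→q₀ x in N , λ {t} → conv t)

      T : ℕ
      T = proj₁ convergence

      converged : ∀ {x} → x < Kψ → Converged x T
      converged = proj₂ convergence

      boundΔ : ∃[ K ] ∀ {x} → x < Kψ → SettlesΔ T x K
      boundΔ = common-bound (SettlesΔ T) Settles-≤ Kψ (λ {x} _ → eval-settles (Δ↓ (pair T x)))

      KΔ : ℕ
      KΔ = proj₁ boundΔ

      settlesΔ : ∀ {x} → x < Kψ → SettlesΔ T x KΔ
      settlesΔ = proj₂ boundΔ

      module Stage {n : ℕ} {u : Oracle} (u⊑c : u ⊑ total c) (u≈c : Agrees u c n) where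

        approxInstance-⊑ : approxInstance u ⊑ total p
        approxInstance-⊑ x e = joinₒ-total x (joinₒ-mono (λ _ e′ → e′) u⊑c x e)

        approxInstance-agrees : Agrees (approxInstance u) p n
        approxInstance-agrees = joinₒ-agrees (λ _ → refl) u≈c

        approxTerm-sound : ∀ {t x v} → approxTerm n u t x ≡ just v → v ≡ d (pair t x)
        approxTerm-sound {t} {x} =
          run-sound {k = n} approxInstance-⊑ (proj₂ (eval-settles (Δ↓ (pair t x)))) (λ _ → refl)

        approxSolution-sound : ∀ {t j v} → T ≤ t → j ≤ k₀ →
                               approxSolution n u t j ≡ just v → v ≡ s j
        approxSolution-sound {t} T≤t j≤k₀ = run-sound {k = n}
          (joinₒ-mono approxInstance-⊑ (λ x e → cong just (sym (approxTerm-sound {t} {x} e))))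
          (settlesΨ (s≤s j≤k₀))
          (joinₒ-agrees (λ _ → refl) (λ x<Kψ → cong just (converged x<Kψ T≤t)))

        module _ (T≤n : T ≤ n) (k₀<n : k₀ < n) (Kψ≤n : Kψ ≤ n) (KΔ≤n : KΔ ≤ n) where

          approxTerm-T : ∀ {x} → x < Kψ → approxTerm n u T x ≡ just (q₀ x)
          approxTerm-T x<Kψ = trans (settlesΔ x<Kψ KΔ≤n (Agrees-≤ KΔ≤n approxInstance-agrees))
                                    (cong just (converged x<Kψ ≤-refl))

          approxSolution-T : ∀ {j} → j ≤ k₀ → approxSolution n u T j ≡ just (s j)
          approxSolution-T j≤k₀ =
            settlesΨ (s≤s j≤k₀) Kψ≤n
              (joinₒ-agrees (Agrees-≤ Kψ≤n approxInstance-agrees) approxTerm-T)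

          trial-T : trial n u T ≡ just (c k₀)
          trial-T = trans (>>=-just u (firstIndexOf-complete n _ first-T k₀<n)) (u≈c k₀<n)
            where
            first-T : FirstIndexOf 1 (approxSolution n u T) k₀
            first-T = FirstIndexOf-transfer (λ j≤k₀ e → trans (approxSolution-T j≤k₀) e) first

          trial-sound : ∀ {t a} → T ≤ t → trial n u t ≡ just a → a ≡ c k₀
          trial-sound {t} T≤t e
            with k , found , uk ← >>=-just⁻¹ (firstIndexOf 1 n (approxSolution n u t)) e
            with refl ← FirstIndexOf-unique (proj₂ (firstIndexOf-sound n _ found)) first
                (λ j≤k₀ Sj sj → trans (approxSolution-sound T≤t j≤k₀ Sj) (just-injective sj))
            = sym (just-injective (u⊑c _ uk))

          guess-correct : guess n u ≡ c k₀
          guess-correct = cong (fromMaybe 0) (latest-eventually trial-T trial-sound T≤n)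

    guess-eventually : ∃[ M ] ∀ {n u} → M ≤ n → u ⊑ total c → Agrees u c n → guess n u ≡ c k₀
    guess-eventually = T ⊔ suc k₀ ⊔ Kψ ⊔ KΔ , λ M≤n u⊑c u≈c →
      let M′≤n = m⊔n≤o⇒m≤o (T ⊔ suc k₀ ⊔ Kψ) KΔ M≤n
          M″≤n = m⊔n≤o⇒m≤o (T ⊔ suc k₀) Kψ M′≤n in
      Stage.guess-correct u⊑c u≈c (m⊔n≤o⇒m≤o T (suc k₀) M″≤n) (m⊔n≤o⇒n≤o T (suc k₀) M″≤n)
                                  (m⊔n≤o⇒n≤o (T ⊔ suc k₀) Kψ M′≤n) (m⊔n≤o⇒n≤o (T ⊔ suc k₀ ⊔ Kψ) KΔ M≤n)

  colouring-defeats : ∀ {d q₀ s k₀} → Computes Δ (join A colouring) d → IsLimit d q₀ →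
                      Computes Ψ (join (join A colouring) q₀) s → FirstIndexOf 1 (total s) k₀ →
                      ∃[ M ] ∀ {n} → M ≤ n → colouring n ≢ colouring k₀
  colouring-defeats {k₀ = k₀} Δ↓ d→q₀ Ψ↓ first
    with M , eventually ← guess-eventually Δ↓ d→q₀ Ψ↓ first =
    M , λ {n} M≤n n≡k₀ → otherColour-≢ _ (trans (sym (cong otherColour (guess-n M≤n))) n≡k₀)
    where
    guess-n : ∀ {n} → M ≤ n → guess n (restrict (prefix n) n) ≡ colouring k₀
    guess-n {n} M≤n =
      eventually M≤n (restrict-⊑ {n = n} prefix-colouring) (restrict-agrees {n = n} prefix-colouring)

-- A presentation of ℚ

nextPair : ℕ × ℕ → ℕ × ℕ
nextPair (suc a , b) = a , suc b
nextPair (zero , b)  = suc b , 0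

unpair : ℕ → ℕ × ℕ
unpair zero    = 0 , 0
unpair (suc n) = nextPair (unpair n)

pair-suc : ∀ a b → pair a (suc b) ≡ suc (pair (suc a) b)
pair-suc a b = trans (cong (λ m → tri m + suc b) (+-suc a b)) (+-suc (tri (suc a + b)) b)

pair-zero : ∀ b → pair (suc b) 0 ≡ suc (pair 0 b)
pair-zero b = begin
  tri (suc b + 0) + 0 ≡⟨ +-identityʳ _ ⟩
  tri (suc b + 0)     ≡⟨ cong tri (+-identityʳ (suc b)) ⟩
  suc (b + tri b)     ≡⟨ cong suc (+-comm b (tri b)) ⟩
  suc (pair 0 b)      ∎
  where open ≡-Reasoning

unpair-pair : ∀ a b → unpair (pair a b) ≡ (a , b)
unpair-pair a b = along-diagonal (a + b) a b refl
  where
  along-diagonal : ∀ s a b → a + b ≡ s → unpair (pair a b) ≡ (a , b)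
  along-diagonal s       a       (suc b) a+b≡s = trans (cong unpair (pair-suc a b))
    (cong nextPair (along-diagonal s (suc a) b (trans (sym (+-suc a b)) a+b≡s)))
  along-diagonal (suc s) (suc a) zero    a+b≡s = trans (cong unpair (pair-zero a))
    (cong nextPair (along-diagonal s 0 a (suc-injective (trans (sym (+-identityʳ (suc a))) a+b≡s))))
  along-diagonal _       zero    zero    _     = refl

toℤ : ℕ × ℕ → ℤ
toℤ (a , zero)  = + a
toℤ (a , suc _) = -[1+ a ]

decodeℤ : ℕ → ℤ
decodeℤ = toℤ ∘ unpair

encodeℤ : ℤ → ℕ
encodeℤ (+ a)    = pair a 0
encodeℤ -[1+ a ] = pair a 1

decodeℤ-encodeℤ : ∀ z → decodeℤ (encodeℤ z) ≡ z
decodeℤ-encodeℤ (+ a)    = cong toℤ (unpair-pair a 0)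
decodeℤ-encodeℤ -[1+ a ] = cong toℤ (unpair-pair a 1)

decodeℚ : ℕ → ℚ
decodeℚ n = decodeℤ (proj₁ (unpair n)) / suc (proj₂ (unpair n))

decodeℚ-onto : ∀ q → ∃[ n ] decodeℚ n ≡ q
decodeℚ-onto q@(mkℚ z d _) = pair (encodeℤ z) d , (begin
  decodeℚ (pair (encodeℤ z) d) ≡⟨ cong (λ (x , d) → decodeℤ x / suc d) (unpair-pair (encodeℤ z) d) ⟩
  decodeℤ (encodeℤ z) / suc d  ≡⟨ cong (_/ suc d) (decodeℤ-encodeℤ z) ⟩
  ↥ q / ↧ₙ q                   ≡⟨ ↥p/↧p≡p q ⟩
  q                            ∎)
  where open ≡-Reasoning

fromℕ : ℕ → ℚ
fromℕ k = mkℚ (+ k) 0 (coprime-sym (1-coprimeTo k))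

height : ℚ → ℕ
height q = ∣ ↥ q ∣ℤ

fromℕ-injective : Injective _≡_ _≡_ fromℕ
fromℕ-injective = cong height

height≤sum : ∀ {q L} → q ∈ L → height q ≤ sum (map height L)
height≤sum {L = q ∷ L}  (here refl) = m≤m+n (height q) _
height≤sum {L = q′ ∷ L} (there q∈L) = ≤-trans (height≤sum q∈L) (m≤n+m _ (height q′))

ℚ-avoid : ∀ (L : List ℚ) → ∃[ q ] q ∉ L
ℚ-avoid L = fromℕ (suc (sum (map height L))) , 1+n≰n ∘ height≤sum

module Deduplicate {A : Set} (_≟_ : DecidableEquality A) (g : ℕ → A)
                   (g-onto : ∀ y → ∃[ m ] g m ≡ y) (avoid : ∀ (L : List A) → ∃[ y ] y ∉ L) where

  open import Data.List.Membership.DecPropositional _≟_ using (_∈?_)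

  fresh : (L : List A) → ∃ (Least (λ m → g m ∉ L))
  fresh L = let y , y∉L = avoid L ; m , gm≡y = g-onto y in
    ∃-least (λ m → ¬? (g m ∈? L)) (subst (_∉ L) (sym gm≡y) y∉L)

  enumerated : ℕ → List A
  enumerate : ℕ → A

  enumerated zero    = []
  enumerated (suc n) = enumerate n ∷ enumerated n

  enumerate n = g (proj₁ (fresh (enumerated n)))

  enumerate-∈ : ∀ {j n} → j < n → enumerate j ∈ enumerated n
  enumerate-∈ {j} {suc n} j<1+n with m≤n⇒m<n∨m≡n (s≤s⁻¹ j<1+n)
  ... | inj₁ j<n  = there (enumerate-∈ j<n)
  ... | inj₂ refl = here refl

  enumerate-∉ : ∀ n → enumerate n ∉ enumerated n
  enumerate-∉ n = proj₁ (proj₂ (fresh (enumerated n)))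

  enumerate-injective : Injective _≡_ _≡_ enumerate
  enumerate-injective {a} {b} ea≡eb with <-cmp a b
  ... | tri< a<b _ _ = contradiction (subst (_∈ enumerated b) ea≡eb (enumerate-∈ a<b)) (enumerate-∉ b)
  ... | tri≈ _ a≡b _ = a≡b
  ... | tri> _ _ b<a = contradiction (subst (_∈ enumerated a) (sym ea≡eb) (enumerate-∈ b<a)) (enumerate-∉ a)

  ∈-enumerated : ∀ {y n} → y ∈ enumerated n → ∃[ j ] enumerate j ≡ y
  ∈-enumerated {n = suc n} (here refl)  = n , refl
  ∈-enumerated {n = suc n} (there y∈L) = ∈-enumerated y∈L

  g-∈-enumerated : ∀ {m n} → m < n → g m ∈ enumerated n
  g-∈-enumerated {m} {suc n} m<1+n with m≤n⇒m<n∨m≡n (s≤s⁻¹ m<1+n)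
  ... | inj₁ m<n  = there (g-∈-enumerated m<n)
  ... | inj₂ refl with g m ∈? enumerated m
  ...   | yes gm∈L = there gm∈L
  ...   | no gm∉L with k , gk∉L , below ← fresh (enumerated m) with <-cmp k m
  ...     | tri< k<m _ _ = contradiction (g-∈-enumerated k<m) gk∉L
  ...     | tri≈ _ refl _ = here refl
  ...     | tri> _ _ m<k = contradiction gm∉L (below m<k)

  enumerate-surjective : Surjective _≡_ _≡_ enumerate
  enumerate-surjective = strictlySurjective⇒surjective λ y →
    let m , gm≡y = g-onto y in
    subst (λ z → ∃[ j ] enumerate j ≡ z) gm≡y (∈-enumerated (g-∈-enumerated (n<1+n m)))

  enumerate-bijective : Bijective _≡_ _≡_ enumerate
  enumerate-bijective = enumerate-injective , enumerate-surjective

indicator : {P : Set} → Dec P → ℕ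
indicator (yes _) = 1
indicator (no _)  = 0

indicator≡1⇔ : {P : Set} (P? : Dec P) → indicator P? ≡ 1 ⇔ P
indicator≡1⇔ (yes p)  = mk⇔ (λ _ → p) (λ _ → refl)
indicator≡1⇔ (no ¬p) = mk⇔ (λ ()) (λ p → contradiction p ¬p)

presentation : (ℕ → ℚ) → Baire
presentation e x = indicator (e (proj₁ (unpair x)) <ℚ? e (proj₂ (unpair x)))

presentation-isQPres : ∀ {e} → Bijective _≡_ _≡_ e → IsQPres (presentation e)
presentation-isQPres {e} bijective = e , bijective , λ a b →
  subst (λ (a′ , b′) → indicator (e a′ <ℚ? e b′) ≡ 1 ⇔ e a <ℚ e b) (sym (unpair-pair a b))
        (indicator≡1⇔ (e a <ℚ? e b))

IsQPres-resp : ∀ {A B} → (∀ x → A x ≡ B x) → IsQPres A → IsQPres B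
IsQPres-resp A≡B (f , bijective , iso) = f , bijective , λ a b → mk⇔
  (λ Bab → Equivalence.to (iso a b) (trans (A≡B (pair a b)) Bab))
  (λ fa<fb → trans (sym (A≡B (pair a b))) (Equivalence.from (iso a b) fa<fb))

Elem-≡ : ∀ {s} {x y : Elem s} → proj₁ x ≡ proj₁ y → x ≡ y
Elem-≡ {x = a , sa} {y = .a , sa′} refl = cong (a ,_) (≡-irrelevant sa sa′)

module _ {A : Set} {e : ℕ → A} (e-injective : Injective _≡_ _≡_ e)
         {s : Baire} {M : ℕ} (bounded : ∀ m → s m ≡ 1 → m < M) where

  bounded-not-onto : (f : Elem s → A) → ¬ Surjective _≡_ _≡_ f
  bounded-not-onto f onto = collision (pigeonhole (n<1+n M) index)
    where
    preimage : ℕ → Elem s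
    preimage k = proj₁ (onto (e k))

    preimage-correct : ∀ k → f (preimage k) ≡ e k
    preimage-correct k = proj₂ (onto (e k)) refl

    index : Fin (suc M) → Fin M
    index k = fromℕ< (uncurry bounded (preimage (toℕ k)))

    collision : ∃₂ (λ i j → i Fin.< j × index i ≡ index j) → ⊥
    collision (i , j , i<j , same-index) = <-irrefl (e-injective (begin
      e (toℕ i)            ≡⟨ preimage-correct (toℕ i) ⟨
      f (preimage (toℕ i)) ≡⟨ cong f (Elem-≡ same-preimage) ⟩
      f (preimage (toℕ j)) ≡⟨ preimage-correct (toℕ j) ⟩
      e (toℕ j)            ∎)) i<j
      where
      open ≡-Reasoning
      same-preimage : proj₁ (preimage (toℕ i)) ≡ proj₁ (preimage (toℕ j))
      same-preimage = trans (sym (toℕ-fromℕ< _)) (trans (cong toℕ same-index) (toℕ-fromℕ< _))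

open Deduplicate _≟ℚ_ decodeℚ decodeℚ-onto ℚ-avoid
  renaming (enumerate to ℚ-enumeration; enumerate-bijective to ℚ-enumeration-bijective)

-- Opaque: otherwise type-checking the theorem below unfolds this enumeration and exhausts memory.
opaque
  ℚ-presentation : Baire
  ℚ-presentation = presentation ℚ-enumeration

  ℚ-presentation-isQPres : IsQPres ℚ-presentation
  ℚ-presentation-isQPres = presentation-isQPres ℚ-enumeration-bijective

diagonal-instance : PR 1 → PR 1 → Baire
diagonal-instance Δ Ψ = join ℚ-presentation (Diagonal.colouring ℚ-presentation Δ Ψ)

diagonal-instance-valid : ∀ Δ Ψ → Dom IndQ2 (diagonal-instance Δ Ψ)
diagonal-instance-valid Δ Ψ =
  IsQPres-resp (λ x → sym (left-join ℚ-presentation colouring x)) ℚ-presentation-isQPres ,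
  λ n → subst (_< 2) (sym (right-join ℚ-presentation colouring n))
              (otherColour<2 (guess n (restrict (prefix n) n)))
  where
  open Diagonal ℚ-presentation Δ Ψ

proposition4p6 : ¬ (IndQ2 ≤W Lim)
proposition4p6 (Δ , Ψ , reduce) with reduce (diagonal-instance Δ Ψ) (diagonal-instance-valid Δ Ψ)
... | d , Δ↓ , (q₀ , d→q₀) , solve with solve q₀ d→q₀
... | s , Ψ↓ , (i , monochromatic) , (f , (_ , f-onto) , _)
  with k₀ , first ← ∃-FirstIndexOf (proj₂ (proj₁ (f-onto 0ℚ)))
  with M , defeated ← Diagonal.colouring-defeats ℚ-presentation Δ Ψ Δ↓ d→q₀ Ψ↓ first =
  bounded-not-onto fromℕ-injective bounded f f-onto
  where
  open Diagonal ℚ-presentation Δ Ψ using (colouring)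

  coloured-i : ∀ {n} → s n ≡ 1 → colouring n ≡ i
  coloured-i {n} sn = trans (sym (right-join ℚ-presentation colouring n)) (monochromatic n sn)

  bounded : ∀ n → s n ≡ 1 → n < M
  bounded n sn = ≰⇒> λ M≤n →
    defeated M≤n (trans (coloured-i sn) (sym (coloured-i (just-injective (proj₁ first)))))
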